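{- The intersection of two stretching classes is either empty, a single root, or a stretching class.
   Context: Setting: $\Phi$ is the root system of a crystallographic Cartan matrix for a Coxeter group with diagram $G$, with elastic data $(x,L_x,R_x)$ ($x$ a vertex, $L_x\sqcup R_x$ a partition of its neighbors); $\mathrm{st}_n(G)$ replaces $x$ by a path $x_0-\cdots-x_n$ of unlabeled edges with $x_0$ joined to $L_x$ and $x_n$ to $R_x$, and $\mathrm{st}_n(\Phi)$ is the corresponding stretched root system. Roots are identified with integer-valued functions on vertices. Stretching class: given an integer-valued function $b$ on the vertices of some $\mathrm{st}_m(G)$ and a marking (asterisks) of one or more consecutive path vertices $x_p,\dots,x_q$ with $b(x_j)\ne b(x_{j+1})$ for $p\le j<q$, the class consists of all functions on vertices of $\mathrm{st}_n(G)$ (for any $n$) agreeing with $b$ off the path, with values $b(x_0),\dots,b(x_{p-1})$ on $x_0,\dots,x_{p-1}$, values $b(x_{q+1}),\dots,b(x_m)$ on the last $m-q$ path vertices, and on the remaining path vertices the values $b(x_p),\dots,b(x_q)$ in this order, each repeated a positive number of times. If one element of a stretching class is a root then all are, and stretching classes are regarded as subsets of $\bigsqcup_n\mathrm{st}_n(\Phi)$. -}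

module Defs where

open import Data.Nat using (ℕ; zero; suc; _≡ᵇ_)
open import Data.Integer using (ℤ; +_; -[1+_]; 0ℤ; 1ℤ; _+_; _-_; _*_; _≤_)
open import Data.Fin using (Fin; zero; suc; toℕ)
import Data.Fin as Fin
open import Data.Bool using (Bool; true; false; if_then_else_; _∧_; not)
open import Data.Sum using (_⊎_; inj₁; inj₂; [_,_])
open import Data.Sum.Properties using (≡-dec)
open import Data.Product using (Σ; _×_; _,_)
open import Data.Empty using (⊥)
open import Data.List using (List; []; _∷_; _++_; length; replicate)
import Data.List as List
open import Data.List.Relation.Unary.Linked using (Linked)
open import Data.Vec using (Vec; []; _∷_)
open import Relation.Nullary using (¬_; yes; no)
open import Relation.Binary.PropositionalEquality using (_≡_; _≢_)
open import Function.Bundles using (_⇔_)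

-- The Coxeter diagram G has vertex set  Fin k ⊎ Fin 1 , where the
-- distinguished (elastic) vertex x is  inj₂ zero  and  Fin k  are the
-- other vertices (any finite graph with a distinguished vertex is of
-- this form up to relabelling).
-- A is an integer (crystallographic) Cartan matrix realising G:
-- A v v = 2, A v w ≤ 0 for v ≠ w, A v w = 0 ⇔ A w v = 0; the edges of G
-- are the pairs with A v w ≠ 0 (labels m_vw determined by A v w * A w v).
-- isL encodes the partition L_x ⊔ R_x of the neighbours of x:
-- a neighbour i of x lies in L_x iff isL i ≡ true (values of isL at
-- non-neighbours are irrelevant).

record ElasticCartan : Set where
  field
    k       : ℕ
    A       : Fin k ⊎ Fin 1 → Fin k ⊎ Fin 1 → ℤ
    diag    : ∀ v → A v v ≡ + 2
    offdiag : ∀ v w → v ≢ w → A v w ≤ 0ℤ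
    zeroSym : ∀ v w → A v w ≡ 0ℤ → A w v ≡ 0ℤ
    isL     : Fin k → Bool

sumFin : (m : ℕ) → (Fin m → ℤ) → ℤ
sumFin zero    f = 0ℤ
sumFin (suc m) f = f zero + sumFin m (λ i → f (suc i))

-- Cartan entries along a path with unlabelled edges (indices = positions)
pathEntry : ℕ → ℕ → ℤ
pathEntry zero    zero          = + 2
pathEntry zero    (suc zero)    = -[1+ 0 ]
pathEntry zero    (suc (suc _)) = 0ℤ
pathEntry (suc zero) zero       = -[1+ 0 ]
pathEntry (suc (suc _)) zero    = 0ℤ
pathEntry (suc a) (suc b)       = pathEntry a b

module _ (D : ElasticCartan) where
  open ElasticCartan D

  x : Fin k ⊎ Fin 1
  x = inj₂ zero

  -- vertices of st_n(G): the other vertices, and the path x_0 - ... - x_n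
  V : ℕ → Set
  V n = Fin k ⊎ Fin (suc n)

  -- Cartan matrix of st_n(G): x_0 is joined to L_x, x_n to R_x with the
  -- Cartan entries of x; path edges unlabelled. st_0(G) = G.
  stA : (n : ℕ) → V n → V n → ℤ
  stA n (inj₁ i) (inj₁ j) = A (inj₁ i) (inj₁ j)
  stA n (inj₁ i) (inj₂ p) =
    (if (toℕ p ≡ᵇ 0) ∧ isL i then A (inj₁ i) x else 0ℤ)
    + (if (toℕ p ≡ᵇ n) ∧ not (isL i) then A (inj₁ i) x else 0ℤ)
  stA n (inj₂ p) (inj₁ j) =
    (if (toℕ p ≡ᵇ 0) ∧ isL j then A x (inj₁ j) else 0ℤ)
    + (if (toℕ p ≡ᵇ n) ∧ not (isL j) then A x (inj₁ j) else 0ℤ)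
  stA n (inj₂ p) (inj₂ q) = pathEntry (toℕ p) (toℕ q)

  sumV : (n : ℕ) → (V n → ℤ) → ℤ
  sumV n f = sumFin k (λ i → f (inj₁ i)) + sumFin (suc n) (λ p → f (inj₂ p))

  simpleRoot : (n : ℕ) → V n → V n → ℤ
  simpleRoot n v u with ≡-dec Fin._≟_ Fin._≟_ v u
  ... | yes _ = 1ℤ
  ... | no  _ = 0ℤ

  -- simple reflection s_v (convention A v w = ⟨α_v^∨ , α_w⟩):
  -- s_v(f) = f - (Σ_w A v w f(w)) α_v
  reflection : (n : ℕ) → V n → (V n → ℤ) → V n → ℤ
  reflection n v f u with ≡-dec Fin._≟_ Fin._≟_ v u
  ... | yes _ = f u - sumV n (λ w → stA n v w * f w)
  ... | no  _ = f u

  data IsRootF (n : ℕ) : (V n → ℤ) → Set where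
    simple  : ∀ v {f} → (∀ u → f u ≡ simpleRoot n v u) → IsRootF n f
    reflect : ∀ v {f h} → IsRootF n f →
              (∀ u → h u ≡ reflection n v f u) → IsRootF n h

  -- An integer function on the vertices of some st_n(G) is written as
  -- (g , w): g = values off the path, w = [value at x_0, ..., value at x_n].
  -- IsRoot g w : (g , w) ∈ ⊔_n st_n(Φ)  (with n + 1 = length w).
  IsRoot : (Fin k → ℤ) → List ℤ → Set
  IsRoot g []       = ⊥
  IsRoot g (v ∷ vs) = IsRootF (length vs) [ g , List.lookup (v ∷ vs) ]

  -- replicate the i-th value (suc (ks i)) times, i.e. a positive number
  expand : (vs : List ℤ) → Vec ℕ (length vs) → List ℤ
  expand []       []       = []
  expand (v ∷ vs) (m ∷ ms) = replicate (suc m) v ++ expand vs ms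

  -- A stretching class, given by a base function b on st_m(G), which is a
  -- root, with path values  pre ++ mid ++ suf  where mid = values at the
  -- marked vertices x_p..x_q (nonempty, consecutive values distinct).
  record SClass : Set where
    field
      base     : Fin k → ℤ
      pre      : List ℤ
      midHead  : ℤ
      midTail  : List ℤ
      suf      : List ℤ
      distinct : Linked _≢_ (midHead ∷ midTail)
      baseRoot : IsRoot base (pre ++ (midHead ∷ midTail) ++ suf)

  _∈SC_ : (Fin k → ℤ) × List ℤ → SClass → Set
  (g , w) ∈SC C =
    IsRoot g w
    × (∀ i → g i ≡ base i)
    × Σ (Vec ℕ (length (midHead ∷ midTail)))
        (λ ms → w ≡ pre ++ expand (midHead ∷ midTail) ms ++ suf)
    where open SClass C

  Subset : Set₁
  Subset = (Fin k → ℤ) × List ℤ → Set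

  classSet : SClass → Subset
  classSet C e = e ∈SC C

  _∩_ : Subset → Subset → Subset
  (S ∩ T) e = S e × T e

  IsEmpty : Subset → Set
  IsEmpty S = ∀ e → ¬ S e

  IsSingleRoot : Subset → Set
  IsSingleRoot S = Σ (Fin k → ℤ) λ g₀ → Σ (List ℤ) λ w₀ →
    ∀ g w → S (g , w) ⇔ ((∀ i → g i ≡ g₀ i) × w ≡ w₀)

  IsStretchingClass : Subset → Set
  IsStretchingClass S = Σ SClass λ C → ∀ e → S e ⇔ (e ∈SC C)

{-# OPTIONS --safe #-}
module Submission where

-- First, stretching preserves roots. Pull functions on st_n(G) back along the
-- map collapsing the edge x_j - x_{j+1} of st_{n+1}(G) onto x_j. This sends α_{x_j} to
-- α_{x_j} + α_{x_{j+1}} = s_{x_j} α_{x_{j+1}} and turns s_{x_j} into s_{x_j} s_{x_{j+1}} s_{x_j}, the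
-- reflection in α_{x_j} + α_{x_{j+1}}, while every other simple root and reflection goes to its unique
-- copy. Hence st_n(Φ) is carried into st_{n+1}(Φ), and a stretching class consists of roots.
-- Second, the path words of a stretching class form the language P c₁⁺ ⋯ c_m⁺ S. Cut into maximal
-- runs of equal letters (a unique decomposition), such a language prescribes the letter of each run
-- and a length that is either exact or only bounded below; the bounded runs are consecutive and all
-- but the outer two of them have minimal length one. Two such languages meet run by run, the length
-- constraints intersect, and the result keeps this shape: it is empty, a single word (no bounded run
-- left), or again the path language of a stretching class.

open import Defs
open import Data.Bool using (Bool; true; false; if_then_else_; _∧_; _∨_; not)
open import Data.Empty using (⊥; ⊥-elim)
open import Data.Fin as Fin using (Fin; zero; suc; toℕ; fromℕ; inject₁; punchIn; pinch)
import Data.Fin.Properties as Finₚ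
open import Data.Integer as ℤ using (ℤ; +_; 0ℤ; 1ℤ; _+_; _-_; _*_; -_)
import Data.Integer.Properties as ℤₚ
open import Data.Integer.Tactic.RingSolver using (solve-∀)
open import Data.List as List using (List; []; _∷_; _++_; length; replicate)
import Data.List.Properties as Listₚ
open import Data.List.Relation.Unary.Linked as Linked using (Linked; []; [-]; _∷_)
open import Data.Nat as ℕ using (ℕ; zero; suc; _≡ᵇ_; _≤_; s≤s; _⊔_; _∸_)
import Data.Nat.Properties as ℕₚ
open import Data.Product using (Σ; _×_; _,_; proj₁; proj₂)
open import Data.Sum as Sum using (_⊎_; inj₁; inj₂; [_,_])
import Data.Sum.Properties as Sumₚ
open import Data.Unit using (⊤; tt)
open import Data.Vec as Vec using (Vec)
open import Function using (_∘_)
open import Function.Bundles using (_⇔_; mk⇔; Equivalence)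
import Function.Properties.Equivalence as ⇔
open import Relation.Binary.PropositionalEquality hiding ([_])
open import Relation.Nullary using (¬_; Dec; yes; no)

cong₃ : ∀ {A B C E : Set} (f : A → B → C → E) {a a′ b b′ c c′} → a ≡ a′ → b ≡ b′ → c ≡ c′ → f a b c ≡ f a′ b′ c′
cong₃ f refl refl refl = refl

sumFin-cong : ∀ m {f g : Fin m → ℤ} → (∀ i → f i ≡ g i) → sumFin m f ≡ sumFin m g
sumFin-cong zero    f≗g = refl
sumFin-cong (suc m) f≗g = cong₂ _+_ (f≗g zero) (sumFin-cong m (f≗g ∘ suc))

sumFin-zero : ∀ m {f : Fin m → ℤ} → (∀ i → f i ≡ 0ℤ) → sumFin m f ≡ 0ℤ
sumFin-zero zero    f≗0 = refl
sumFin-zero (suc m) f≗0 = cong₂ _+_ (f≗0 zero) (sumFin-zero m (f≗0 ∘ suc))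

sumFin-+ : ∀ m (f g : Fin m → ℤ) → sumFin m (λ i → f i + g i) ≡ sumFin m f + sumFin m g
sumFin-+ zero    f g = refl
sumFin-+ (suc m) f g =
  trans (cong (_+_ (f zero + g zero)) (sumFin-+ m (f ∘ suc) (g ∘ suc)))
        (interchange (f zero) (g zero) _ _)
  where
  interchange : ∀ a b c d → a + b + (c + d) ≡ a + c + (b + d)
  interchange = solve-∀

sumFin-*-sub : ∀ m (a f e : Fin m → ℤ) c →
  sumFin m (λ i → a i * (f i - c * e i))
    ≡ sumFin m (λ i → a i * f i) - c * sumFin m (λ i → a i * e i)
sumFin-*-sub zero    a f e c = sym (annihilate c)
  where
  annihilate : ∀ c → 0ℤ - c * 0ℤ ≡ 0ℤ
  annihilate = solve-∀
sumFin-*-sub (suc m) a f e c =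
  trans (cong (_+_ (a zero * (f zero - c * e zero))) (sumFin-*-sub m (a ∘ suc) (f ∘ suc) (e ∘ suc) c))
        (distribute (a zero) (f zero) (e zero) c _ _)
  where
  distribute : ∀ a f e c s t → a * (f - c * e) + (s - c * t) ≡ a * f + s - c * (a * e + t)
  distribute = solve-∀

sumFin-*-indicator : ∀ m (t : Fin m) (a e : Fin m → ℤ) → e t ≡ 1ℤ → (∀ i → i ≢ t → e i ≡ 0ℤ) →
  sumFin m (λ i → a i * e i) ≡ a t
sumFin-*-indicator (suc m) zero a e et≡1 e≡0 =
  begin
    a zero * e zero + sumFin m (λ i → a (suc i) * e (suc i))
  ≡⟨ cong₂ _+_ (trans (cong (a zero *_) et≡1) (ℤₚ.*-identityʳ (a zero)))
               (sumFin-zero m (λ i → trans (cong (a (suc i) *_) (e≡0 (suc i) λ ())) (ℤₚ.*-zeroʳ (a (suc i))))) ⟩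
    a zero + 0ℤ
  ≡⟨ ℤₚ.+-identityʳ (a zero) ⟩
    a zero
  ∎
  where open ≡-Reasoning
sumFin-*-indicator (suc m) (suc t) a e et≡1 e≡0 =
  trans (cong₂ _+_ (trans (cong (a zero *_) (e≡0 zero λ ())) (ℤₚ.*-zeroʳ (a zero)))
                   (sumFin-*-indicator m t (a ∘ suc) (e ∘ suc) et≡1 (λ i i≢t → e≡0 (suc i) (i≢t ∘ Finₚ.suc-injective))))
        (ℤₚ.+-identityˡ (a (suc t)))

-- Paths: neighbours, pinching and punching in

-- h (p - 1) and h (p + 1), taken to be 0 beyond the ends of the path.
leftOf : ∀ {n} → Fin (suc n) → (Fin (suc n) → ℤ) → ℤ
leftOf zero h = 0ℤ
leftOf {suc n} (suc zero) h = h zero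
leftOf {suc n} (suc (suc p)) h = leftOf (suc p) (h ∘ suc)

rightOf : ∀ n → Fin (suc n) → (Fin (suc n) → ℤ) → ℤ
rightOf zero    zero    h = 0ℤ
rightOf (suc n) zero    h = h (suc zero)
rightOf (suc n) (suc p) h = rightOf n p (h ∘ suc)

pathEntry-sum : ∀ n (p : Fin (suc n)) (h : Fin (suc n) → ℤ) →
  sumFin (suc n) (λ q → pathEntry (toℕ p) (toℕ q) * h q) ≡ + 2 * h p - leftOf p h - rightOf n p h
pathEntry-sum zero zero h = endpoint (h zero)
  where
  endpoint : ∀ a → + 2 * a + 0ℤ ≡ + 2 * a - 0ℤ - 0ℤ
  endpoint = solve-∀
pathEntry-sum (suc n) zero h =
  trans (cong (λ s → + 2 * h zero + (- 1ℤ * h (suc zero) + s)) (sumFin-zero n (λ _ → refl)))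
        (first (h zero) (h (suc zero)))
  where
  first : ∀ a b → + 2 * a + (- 1ℤ * b + 0ℤ) ≡ + 2 * a - 0ℤ - b
  first = solve-∀
pathEntry-sum (suc n) (suc zero) h =
  trans (cong (_+_ (- 1ℤ * h zero)) (pathEntry-sum n zero (h ∘ suc)))
        (second (h (suc zero)) (h zero) (rightOf n zero (h ∘ suc)))
  where
  second : ∀ a b r → - 1ℤ * b + (+ 2 * a - 0ℤ - r) ≡ + 2 * a - b - r
  second = solve-∀
pathEntry-sum (suc n) (suc (suc p)) h =
  trans (ℤₚ.+-identityˡ _) (pathEntry-sum n (suc p) (h ∘ suc))

leftOf-suc : ∀ {n} (p : Fin (suc n)) (h : Fin (suc (suc n)) → ℤ) → p ≢ zero → leftOf (suc p) h ≡ leftOf p (h ∘ suc)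
leftOf-suc zero    h p≢0 = ⊥-elim (p≢0 refl)
leftOf-suc (suc p) h p≢0 = refl

pinch-inject₁ : ∀ {n} (j : Fin (suc n)) → pinch j (inject₁ j) ≡ j
pinch-inject₁ zero            = refl
pinch-inject₁ {suc n} (suc j) = cong suc (pinch-inject₁ j)

pinch-suc : ∀ {n} (j : Fin (suc n)) → pinch j (suc j) ≡ j
pinch-suc zero            = refl
pinch-suc {suc n} (suc j) = cong suc (pinch-suc j)

pinch-punchIn : ∀ {n} (j p : Fin (suc n)) → pinch j (punchIn (suc j) p) ≡ p
pinch-punchIn zero            zero    = refl
pinch-punchIn zero            (suc p) = refl
pinch-punchIn {suc n} (suc j) zero    = refl
pinch-punchIn {suc n} (suc j) (suc p) = cong suc (pinch-punchIn j p)

pinch-fromℕ : ∀ {n} (j : Fin (suc n)) → pinch j (fromℕ (suc n)) ≡ fromℕ n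
pinch-fromℕ {zero}  zero    = refl
pinch-fromℕ {suc n} zero    = refl
pinch-fromℕ {suc n} (suc j) = cong suc (pinch-fromℕ j)

pinch-fibre : ∀ {n} (j : Fin (suc n)) q {p} → pinch j q ≡ p → p ≢ j → q ≡ punchIn (suc j) p
pinch-fibre zero            zero          refl p≢j = ⊥-elim (p≢j refl)
pinch-fibre zero            (suc zero)    refl p≢j = ⊥-elim (p≢j refl)
pinch-fibre zero            (suc (suc q)) refl p≢j = refl
pinch-fibre {suc n} (suc j) zero          refl p≢j = refl
pinch-fibre {suc n} (suc j) (suc q)       refl p≢j = cong suc (pinch-fibre j q refl (p≢j ∘ cong suc))

pinch-fibre-centre : ∀ {n} (j : Fin (suc n)) q → pinch j q ≡ j → q ≡ inject₁ j ⊎ q ≡ suc j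
pinch-fibre-centre zero            zero          _  = inj₁ refl
pinch-fibre-centre zero            (suc zero)    _  = inj₂ refl
pinch-fibre-centre zero            (suc (suc q)) ()
pinch-fibre-centre {suc n} (suc j) zero          ()
pinch-fibre-centre {suc n} (suc j) (suc q)       eq =
  Sum.map (cong suc) (cong suc) (pinch-fibre-centre j q (Finₚ.suc-injective eq))

inject₁≢suc : ∀ {n} (j : Fin n) → inject₁ j ≢ suc j
inject₁≢suc j eq = ℕₚ.1+n≢n (sym (trans (sym (Finₚ.toℕ-inject₁ j)) (cong toℕ eq)))

punchIn-suc≢zero : ∀ {n} (j : Fin (suc n)) (p : Fin n) → punchIn (suc j) (suc p) ≢ zero
punchIn-suc≢zero zero            p ()
punchIn-suc≢zero {suc n} (suc j) p ()

left-inject₁ : ∀ {n} (j : Fin (suc n)) (h : Fin (suc n) → ℤ) → leftOf (inject₁ j) (h ∘ pinch j) ≡ leftOf j h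
left-inject₁ zero                  h = refl
left-inject₁ {suc n} (suc zero)    h = refl
left-inject₁ {suc n} (suc (suc j)) h = left-inject₁ (suc j) (h ∘ suc)

right-inject₁ : ∀ {n} (j : Fin (suc n)) (h : Fin (suc n) → ℤ) → rightOf (suc n) (inject₁ j) (h ∘ pinch j) ≡ h j
right-inject₁ zero            h = refl
right-inject₁ {suc n} (suc j) h = right-inject₁ j (h ∘ suc)

left-suc : ∀ {n} (j : Fin (suc n)) (h : Fin (suc n) → ℤ) → leftOf (suc j) (h ∘ pinch j) ≡ h j
left-suc zero            h = refl
left-suc {suc n} (suc j) h = left-suc j (h ∘ suc)

right-suc : ∀ {n} (j : Fin (suc n)) (h : Fin (suc n) → ℤ) → rightOf (suc n) (suc j) (h ∘ pinch j) ≡ rightOf n j h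
right-suc {zero}  zero    h = refl
right-suc {suc n} zero    h = refl
right-suc {suc n} (suc j) h = right-suc j (h ∘ suc)

left-punchIn : ∀ {n} (j p : Fin (suc n)) (h : Fin (suc n) → ℤ) → p ≢ j →
  leftOf (punchIn (suc j) p) (h ∘ pinch j) ≡ leftOf p h
left-punchIn j                 zero          h p≢j = refl
left-punchIn zero              (suc p)       h p≢j = refl
left-punchIn {suc n} (suc j)   (suc zero)    h p≢j = refl
left-punchIn {suc n} (suc j)   (suc (suc p)) h p≢j =
  trans (leftOf-suc (punchIn (suc j) (suc p)) (h ∘ pinch (suc j)) (punchIn-suc≢zero j p))
        (left-punchIn j (suc p) (h ∘ suc) (p≢j ∘ cong suc))

right-punchIn : ∀ {n} (j p : Fin (suc n)) (h : Fin (suc n) → ℤ) → p ≢ j →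
  rightOf (suc n) (punchIn (suc j) p) (h ∘ pinch j) ≡ rightOf n p h
right-punchIn zero            zero    h p≢j = ⊥-elim (p≢j refl)
right-punchIn {suc n} zero    (suc p) h p≢j = refl
right-punchIn {suc n} (suc j) zero    h p≢j = refl
right-punchIn {suc n} (suc j) (suc p) h p≢j = right-punchIn j p (h ∘ suc) (p≢j ∘ cong suc)

punchIn-≡ᵇ-first : ∀ {n} (j p : Fin (suc n)) → (toℕ (punchIn (suc j) p) ≡ᵇ 0) ≡ (toℕ p ≡ᵇ 0)
punchIn-≡ᵇ-first zero            zero    = refl
punchIn-≡ᵇ-first zero            (suc p) = refl
punchIn-≡ᵇ-first {suc n} (suc j) zero    = refl
punchIn-≡ᵇ-first {suc n} (suc j) (suc p) = refl

punchIn-≡ᵇ-last : ∀ {n} (j p : Fin (suc n)) → p ≢ j → (toℕ (punchIn (suc j) p) ≡ᵇ suc n) ≡ (toℕ p ≡ᵇ n)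
punchIn-≡ᵇ-last zero            zero    p≢j = ⊥-elim (p≢j refl)
punchIn-≡ᵇ-last zero            (suc p) p≢j = refl
punchIn-≡ᵇ-last {suc n} (suc j) zero    p≢j = refl
punchIn-≡ᵇ-last {suc n} (suc j) (suc p) p≢j = punchIn-≡ᵇ-last j p (p≢j ∘ cong suc)

toℕ-≡ᵇ-suc : ∀ {n} (j : Fin (suc n)) → (toℕ j ≡ᵇ suc n) ≡ false
toℕ-≡ᵇ-suc zero            = refl
toℕ-≡ᵇ-suc {suc n} (suc j) = toℕ-≡ᵇ-suc j

pathEntry-diag : ∀ a → pathEntry a a ≡ + 2
pathEntry-diag zero          = refl
pathEntry-diag (suc zero)    = refl
pathEntry-diag (suc (suc a)) = pathEntry-diag (suc a)

pathEntry-next : ∀ a → pathEntry a (suc a) ≡ - 1ℤ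
pathEntry-next zero          = refl
pathEntry-next (suc zero)    = refl
pathEntry-next (suc (suc a)) = pathEntry-next (suc a)

pathEntry-prev : ∀ a → pathEntry (suc a) a ≡ - 1ℤ
pathEntry-prev zero          = refl
pathEntry-prev (suc zero)    = refl
pathEntry-prev (suc (suc a)) = pathEntry-prev (suc a)

sumFin-*-if-first : ∀ n (b : Bool) (a : ℤ) (h : Fin (suc n) → ℤ) →
  sumFin (suc n) (λ q → (if (toℕ q ≡ᵇ 0) ∧ b then a else 0ℤ) * h q) ≡ (if b then a * h zero else 0ℤ)
sumFin-*-if-first n true  a h = trans (cong (_+_ (a * h zero)) (sumFin-zero n (λ _ → refl))) (ℤₚ.+-identityʳ _)
sumFin-*-if-first n false a h = sumFin-zero (suc n) {λ q → (if (toℕ q ≡ᵇ 0) ∧ false then a else 0ℤ) * h q} λ { zero → refl ; (suc _) → refl }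

sumFin-*-if-last : ∀ n (b : Bool) (a : ℤ) (h : Fin (suc n) → ℤ) →
  sumFin (suc n) (λ q → (if (toℕ q ≡ᵇ n) ∧ b then a else 0ℤ) * h q) ≡ (if b then a * h (fromℕ n) else 0ℤ)
sumFin-*-if-last zero    true  a h = ℤₚ.+-identityʳ _
sumFin-*-if-last zero    false a h = refl
sumFin-*-if-last (suc n) b     a h = trans (ℤₚ.+-identityˡ _) (sumFin-*-if-last n b a (h ∘ suc))

sumFin-+-* : ∀ m (a b h : Fin m → ℤ) →
  sumFin m (λ i → (a i + b i) * h i) ≡ sumFin m (λ i → a i * h i) + sumFin m (λ i → b i * h i)
sumFin-+-* m a b h = trans (sumFin-cong m (λ i → ℤₚ.*-distribʳ-+ (h i) (a i) (b i))) (sumFin-+ m _ _)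

-- The junk value 0 past the end is never used: lengths are matched wherever valueAt is read.
valueAt : List ℤ → ℕ → ℤ
valueAt []       _       = 0ℤ
valueAt (v ∷ vs) zero    = v
valueAt (v ∷ vs) (suc i) = valueAt vs i

lookup-valueAt : ∀ (w : List ℤ) q → List.lookup w q ≡ valueAt w (toℕ q)
lookup-valueAt (v ∷ vs) zero    = refl
lookup-valueAt (v ∷ vs) (suc q) = lookup-valueAt vs q

position : (P : List ℤ) (n : ℕ) → Fin (suc (length P ℕ.+ n))
position []      n = zero
position (a ∷ P) n = suc (position P n)

valueAt-pinch : ∀ P c B (q : Fin (suc (suc (length P ℕ.+ length B)))) →
  valueAt (P ++ c ∷ B) (toℕ (pinch (position P (length B)) q)) ≡ valueAt (P ++ c ∷ c ∷ B) (toℕ q)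
valueAt-pinch []      c B zero    = refl
valueAt-pinch []      c B (suc q) = refl
valueAt-pinch (a ∷ P) c B zero    = refl
valueAt-pinch (a ∷ P) c B (suc q) = valueAt-pinch P c B q

length-++-∷ : ∀ P (c : ℤ) B → length (P ++ c ∷ B) ≡ suc (length P ℕ.+ length B)
length-++-∷ []      c B = refl
length-++-∷ (a ∷ P) c B = cong suc (length-++-∷ P c B)

_≟V_ : ∀ {k n} (v u : Fin k ⊎ Fin n) → Dec (v ≡ u)
_≟V_ = Sumₚ.≡-dec Fin._≟_ Fin._≟_

-- Stretching preserves roots

module RootStretching (D : ElasticCartan) where
  open ElasticCartan D

  pairing : ∀ n → V D n → (V D n → ℤ) → ℤ
  pairing n v f = sumV D n (λ u → stA D n v u * f u)

  root-cong : ∀ {n f g} → IsRootF D n f → (∀ u → f u ≡ g u) → IsRootF D n g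
  root-cong (simple v f≗α)    f≗g = simple v (λ u → trans (sym (f≗g u)) (f≗α u))
  root-cong (reflect v r f≗s) f≗g = reflect v r (λ u → trans (sym (f≗g u)) (f≗s u))

  simpleRoot-self : ∀ n v → simpleRoot D n v v ≡ 1ℤ
  simpleRoot-self n v with v ≟V v
  ... | yes _   = refl
  ... | no  v≢v = ⊥-elim (v≢v refl)

  simpleRoot-other : ∀ n {v u} → v ≢ u → simpleRoot D n v u ≡ 0ℤ
  simpleRoot-other n {v} {u} v≢u with v ≟V u
  ... | yes v≡u = ⊥-elim (v≢u v≡u)
  ... | no  _   = refl

  reflection-≡ : ∀ n v f u → reflection D n v f u ≡ f u - pairing n v f * simpleRoot D n v u
  reflection-≡ n v f u with v ≟V u
  ... | yes _ = cong (_-_ (f u)) (sym (ℤₚ.*-identityʳ (pairing n v f)))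
  ... | no  _ = sym (trans (cong (_-_ (f u)) (ℤₚ.*-zeroʳ (pairing n v f))) (ℤₚ.+-identityʳ (f u)))

  sumV-indicator : ∀ n v (a e : V D n → ℤ) → e v ≡ 1ℤ → (∀ u → u ≢ v → e u ≡ 0ℤ) →
    sumV D n (λ u → a u * e u) ≡ a v
  sumV-indicator n (inj₁ i) a e ev≡1 e≡0 =
    trans (cong₂ _+_
            (sumFin-*-indicator k i (a ∘ inj₁) (e ∘ inj₁) ev≡1 (λ i′ i′≢i → e≡0 (inj₁ i′) (i′≢i ∘ Sumₚ.inj₁-injective)))
            (sumFin-zero (suc n) (λ q → trans (cong (a (inj₂ q) *_) (e≡0 (inj₂ q) λ ())) (ℤₚ.*-zeroʳ (a (inj₂ q))))))
          (ℤₚ.+-identityʳ (a (inj₁ i)))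
  sumV-indicator n (inj₂ p) a e ev≡1 e≡0 =
    trans (cong₂ _+_
            (sumFin-zero k (λ i → trans (cong (a (inj₁ i) *_) (e≡0 (inj₁ i) λ ())) (ℤₚ.*-zeroʳ (a (inj₁ i)))))
            (sumFin-*-indicator (suc n) p (a ∘ inj₂) (e ∘ inj₂) ev≡1 (λ q q≢p → e≡0 (inj₂ q) (q≢p ∘ Sumₚ.inj₂-injective))))
          (ℤₚ.+-identityˡ (a (inj₂ p)))

  pairing-simpleRoot : ∀ n v w → pairing n v (simpleRoot D n w) ≡ stA D n v w
  pairing-simpleRoot n v w =
    sumV-indicator n w (stA D n v) (simpleRoot D n w) (simpleRoot-self n w) (λ u u≢w → simpleRoot-other n (u≢w ∘ sym))

  pairing-cong : ∀ n v {f g : V D n → ℤ} → (∀ u → f u ≡ g u) → pairing n v f ≡ pairing n v g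
  pairing-cong n v f≗g = cong₂ _+_ (sumFin-cong k (λ i → cong (stA D n v (inj₁ i) *_) (f≗g (inj₁ i))))
                                   (sumFin-cong (suc n) (λ q → cong (stA D n v (inj₂ q) *_) (f≗g (inj₂ q))))

  pairing-sub-simpleRoot : ∀ n v w f c →
    pairing n v (λ u → f u - c * simpleRoot D n w u) ≡ pairing n v f - c * stA D n v w
  pairing-sub-simpleRoot n v w f c =
    begin
      pairing n v (λ u → f u - c * simpleRoot D n w u)
    ≡⟨ cong₂ _+_ (sumFin-*-sub k (a ∘ inj₁) (f ∘ inj₁) (e ∘ inj₁) c) (sumFin-*-sub (suc n) (a ∘ inj₂) (f ∘ inj₂) (e ∘ inj₂) c) ⟩
      (sumFin k (λ i → a (inj₁ i) * f (inj₁ i)) - c * sumFin k (λ i → a (inj₁ i) * e (inj₁ i)))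
        + (sumFin (suc n) (λ q → a (inj₂ q) * f (inj₂ q)) - c * sumFin (suc n) (λ q → a (inj₂ q) * e (inj₂ q)))
    ≡⟨ regroup (sumFin k (λ i → a (inj₁ i) * f (inj₁ i))) (sumFin k (λ i → a (inj₁ i) * e (inj₁ i)))
                 (sumFin (suc n) (λ q → a (inj₂ q) * f (inj₂ q))) (sumFin (suc n) (λ q → a (inj₂ q) * e (inj₂ q))) c ⟩
      pairing n v f - c * pairing n v e
    ≡⟨ cong (λ s → pairing n v f - c * s) (pairing-simpleRoot n v w) ⟩
      pairing n v f - c * stA D n v w
    ∎
    where
    open ≡-Reasoning
    a = stA D n v
    e = simpleRoot D n w
    regroup : ∀ x y z t c → (x - c * y) + (z - c * t) ≡ (x + z) - c * (y + t)
    regroup = solve-∀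

  pairing-reflection : ∀ n v w f → pairing n v (reflection D n w f) ≡ pairing n v f - pairing n w f * stA D n v w
  pairing-reflection n v w f =
    trans (pairing-cong n v (reflection-≡ n w f)) (pairing-sub-simpleRoot n v w f (pairing n w f))

  -- For simple roots joined by an unlabelled edge, s_u s_w s_u is the reflection in α_u + α_w.
  reflection-braid : ∀ n u w F → stA D n u u ≡ + 2 → stA D n u w ≡ - 1ℤ → stA D n w u ≡ - 1ℤ → ∀ t →
    reflection D n u (reflection D n w (reflection D n u F)) t
      ≡ F t - (pairing n u F + pairing n w F) * (simpleRoot D n u t + simpleRoot D n w t)
  reflection-braid n u w F uu≡2 uw≡-1 wu≡-1 t =
    begin
      reflection D n u F₂ t
    ≡⟨ reflection-≡ n u F₂ t ⟩
      F₂ t - pairing n u F₂ * δu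
    ≡⟨ cong₂ (λ x y → x - y * δu) (reflection-≡ n w F₁ t) (pairing-reflection n u w F₁) ⟩
      (F₁ t - b₁ * δw) - (pairing n u F₁ - b₁ * stA D n u w) * δu
    ≡⟨ cong₂ (λ x y → (x - b₁ * δw) - (y - b₁ * stA D n u w) * δu) (reflection-≡ n u F t) a₁≡ ⟩
      ((F t - a * δu) - b₁ * δw) - ((a - a * + 2) - b₁ * stA D n u w) * δu
    ≡⟨ cong₂ (λ x y → ((F t - a * δu) - x * δw) - ((a - a * + 2) - x * y) * δu) b₁≡ uw≡-1 ⟩
      ((F t - a * δu) - (b - a * - 1ℤ) * δw) - ((a - a * + 2) - (b - a * - 1ℤ) * - 1ℤ) * δu
    ≡⟨ braid (F t) a b δu δw ⟩
      F t - (a + b) * (δu + δw)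
    ∎
    where
    open ≡-Reasoning
    F₁ = reflection D n u F
    F₂ = reflection D n w F₁
    a = pairing n u F
    b = pairing n w F
    b₁ = pairing n w F₁
    δu = simpleRoot D n u t
    δw = simpleRoot D n w t
    a₁≡ : pairing n u F₁ ≡ a - a * + 2
    a₁≡ = trans (pairing-reflection n u u F) (cong (λ s → a - a * s) uu≡2)
    b₁≡ : b₁ ≡ b - a * - 1ℤ
    b₁≡ = trans (pairing-reflection n w u F) (cong (λ s → b - a * s) wu≡-1)
    braid : ∀ f a b du dw →
      ((f - a * du) - (b - a * - 1ℤ) * dw) - ((a - a * + 2) - (b - a * - 1ℤ) * - 1ℤ) * du ≡ f - (a + b) * (du + dw)
    braid = solve-∀

  -- squash j collapses x_j and x_{j+1} of st_{n+1}(G) onto x_j of st_n(G).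
  squash : ∀ {n} → Fin (suc n) → V D (suc n) → V D n
  squash j (inj₁ i) = inj₁ i
  squash j (inj₂ q) = inj₂ (pinch j q)

  stretch : ∀ {n} → Fin (suc n) → (V D n → ℤ) → V D (suc n) → ℤ
  stretch j f = f ∘ squash j

  record UniqueLift {n} (j : Fin (suc n)) (v : V D n) (v′ : V D (suc n)) : Set where
    field
      squash-lift  : squash j v′ ≡ v
      fibre-lift   : ∀ t → squash j t ≡ v → t ≡ v′
      pairing-lift : ∀ f → pairing n v f ≡ pairing (suc n) v′ (stretch j f)

  module _ {n} {j : Fin (suc n)} {v v′} (lift : UniqueLift j v v′) where
    open UniqueLift lift

    stretch-simpleRoot-lift : ∀ t → stretch j (simpleRoot D n v) t ≡ simpleRoot D (suc n) v′ t
    stretch-simpleRoot-lift t with t ≟V v′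
    ... | yes refl = trans (cong (simpleRoot D n v) squash-lift)
                           (trans (simpleRoot-self n v) (sym (simpleRoot-self (suc n) t)))
    ... | no t≢v′  = trans (simpleRoot-other n (λ v≡ → t≢v′ (fibre-lift t (sym v≡))))
                           (sym (simpleRoot-other (suc n) (t≢v′ ∘ sym)))

    stretch-reflection-lift : ∀ f t → stretch j (reflection D n v f) t ≡ reflection D (suc n) v′ (stretch j f) t
    stretch-reflection-lift f t =
      begin
        reflection D n v f (squash j t)
      ≡⟨ reflection-≡ n v f (squash j t) ⟩
        f (squash j t) - pairing n v f * simpleRoot D n v (squash j t)
      ≡⟨ cong₂ (λ x y → f (squash j t) - x * y) (pairing-lift f) (stretch-simpleRoot-lift t) ⟩
        stretch j f t - pairing (suc n) v′ (stretch j f) * simpleRoot D (suc n) v′ t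
      ≡⟨ sym (reflection-≡ (suc n) v′ (stretch j f) t) ⟩
        reflection D (suc n) v′ (stretch j f) t
      ∎
      where open ≡-Reasoning

  offPath-pathSum : ∀ n i (h : Fin (suc n) → ℤ) →
    sumFin (suc n) (λ q → stA D n (inj₁ i) (inj₂ q) * h q)
      ≡ (if isL i then A (inj₁ i) (x D) * h zero else 0ℤ)
        + (if not (isL i) then A (inj₁ i) (x D) * h (fromℕ n) else 0ℤ)
  offPath-pathSum n i h =
    trans (sumFin-+-* (suc n) (λ q → if (toℕ q ≡ᵇ 0) ∧ isL i then A (inj₁ i) (x D) else 0ℤ)
                              (λ q → if (toℕ q ≡ᵇ n) ∧ not (isL i) then A (inj₁ i) (x D) else 0ℤ) h)
          (cong₂ _+_ (sumFin-*-if-first n (isL i) (A (inj₁ i) (x D)) h)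
                     (sumFin-*-if-last n (not (isL i)) (A (inj₁ i) (x D)) h))

  lift-offPath : ∀ {n} (j : Fin (suc n)) i → UniqueLift j (inj₁ i) (inj₁ i)
  lift-offPath {n} j i = record
    { squash-lift  = refl
    ; fibre-lift   = λ { (inj₁ _) refl → refl }
    ; pairing-lift = λ f → cong (_+_ (sumFin k (λ i′ → A (inj₁ i) (inj₁ i′) * f (inj₁ i′))))
        (trans (offPath-pathSum n i (f ∘ inj₂))
               (sym (trans (offPath-pathSum (suc n) i (f ∘ inj₂ ∘ pinch j))
                           (cong (λ q → (if isL i then A (inj₁ i) (x D) * f (inj₂ zero) else 0ℤ)
                                        + (if not (isL i) then A (inj₁ i) (x D) * f (inj₂ q) else 0ℤ))
                                 (pinch-fromℕ j)))))
    }

  stA-punchIn : ∀ {n} (j p : Fin (suc n)) i → p ≢ j →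
    stA D (suc n) (inj₂ (punchIn (suc j) p)) (inj₁ i) ≡ stA D n (inj₂ p) (inj₁ i)
  stA-punchIn j p i p≢j rewrite punchIn-≡ᵇ-first j p | punchIn-≡ᵇ-last j p p≢j = refl

  lift-path : ∀ {n} (j p : Fin (suc n)) → p ≢ j → UniqueLift j (inj₂ p) (inj₂ (punchIn (suc j) p))
  lift-path {n} j p p≢j = record
    { squash-lift  = cong inj₂ (pinch-punchIn j p)
    ; fibre-lift   = λ { (inj₂ q) eq → cong inj₂ (pinch-fibre j q (Sumₚ.inj₂-injective eq) p≢j) }
    ; pairing-lift = λ f → cong₂ _+_
        (sumFin-cong k (λ i → cong (_* f (inj₁ i)) (sym (stA-punchIn j p i p≢j))))
        (path-part (f ∘ inj₂))
    }
    where
    p′ = punchIn (suc j) p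
    path-part : ∀ h → sumFin (suc n) (λ q → pathEntry (toℕ p) (toℕ q) * h q)
                    ≡ sumFin (suc (suc n)) (λ q → pathEntry (toℕ p′) (toℕ q) * h (pinch j q))
    path-part h =
      begin
        sumFin (suc n) (λ q → pathEntry (toℕ p) (toℕ q) * h q)
      ≡⟨ pathEntry-sum n p h ⟩
        + 2 * h p - leftOf p h - rightOf n p h
      ≡⟨ sym (cong₃ (λ x y z → + 2 * x - y - z) (cong h (pinch-punchIn j p)) (left-punchIn j p h p≢j) (right-punchIn j p h p≢j)) ⟩
        + 2 * h (pinch j p′) - leftOf p′ (h ∘ pinch j) - rightOf (suc n) p′ (h ∘ pinch j)
      ≡⟨ sym (pathEntry-sum (suc n) p′ (h ∘ pinch j)) ⟩
        sumFin (suc (suc n)) (λ q → pathEntry (toℕ p′) (toℕ q) * h (pinch j q))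
      ∎
      where open ≡-Reasoning

  module Centre {n} (j : Fin (suc n)) where
    lo hi : V D (suc n)
    lo = inj₂ (inject₁ j)
    hi = inj₂ (suc j)

    lo≢hi : lo ≢ hi
    lo≢hi = inject₁≢suc j ∘ Sumₚ.inj₂-injective

    stA-lo-lo : stA D (suc n) lo lo ≡ + 2
    stA-lo-lo = pathEntry-diag (toℕ (inject₁ j))

    stA-lo-hi : stA D (suc n) lo hi ≡ - 1ℤ
    stA-lo-hi = trans (cong (λ a → pathEntry a (suc (toℕ j))) (Finₚ.toℕ-inject₁ j)) (pathEntry-next (toℕ j))

    stA-hi-lo : stA D (suc n) hi lo ≡ - 1ℤ
    stA-hi-lo = trans (cong (pathEntry (suc (toℕ j))) (Finₚ.toℕ-inject₁ j)) (pathEntry-prev (toℕ j))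

    stA-offPath-split : ∀ i → stA D (suc n) lo (inj₁ i) + stA D (suc n) hi (inj₁ i) ≡ stA D n (inj₂ j) (inj₁ i)
    stA-offPath-split i rewrite Finₚ.toℕ-inject₁ j | toℕ-≡ᵇ-suc j =
      pad (if (toℕ j ≡ᵇ 0) ∧ isL i then A (x D) (inj₁ i) else 0ℤ) (if (toℕ j ≡ᵇ n) ∧ not (isL i) then A (x D) (inj₁ i) else 0ℤ)
      where
      pad : ∀ a b → a + 0ℤ + (0ℤ + b) ≡ a + b
      pad = solve-∀

    fibre-centre : ∀ t → squash j t ≡ inj₂ j → t ≡ lo ⊎ t ≡ hi
    fibre-centre (inj₂ q) eq = Sum.map (cong inj₂) (cong inj₂) (pinch-fibre-centre j q (Sumₚ.inj₂-injective eq))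

    stretch-simpleRoot-centre : ∀ t → stretch j (simpleRoot D n (inj₂ j)) t ≡ simpleRoot D (suc n) lo t + simpleRoot D (suc n) hi t
    stretch-simpleRoot-centre t with t ≟V lo | t ≟V hi
    ... | yes refl | _ =
      trans (cong (simpleRoot D n (inj₂ j) ∘ inj₂) (pinch-inject₁ j))
            (trans (simpleRoot-self n _) (sym (cong₂ _+_ (simpleRoot-self (suc n) lo) (simpleRoot-other (suc n) (lo≢hi ∘ sym)))))
    ... | no _ | yes refl =
      trans (cong (simpleRoot D n (inj₂ j) ∘ inj₂) (pinch-suc j))
            (trans (simpleRoot-self n _) (sym (cong₂ _+_ (simpleRoot-other (suc n) lo≢hi) (simpleRoot-self (suc n) hi))))
    ... | no t≢lo | no t≢hi =
      trans (simpleRoot-other n (λ j≡ → [ t≢lo , t≢hi ] (fibre-centre t (sym j≡))))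
            (sym (cong₂ _+_ (simpleRoot-other (suc n) (t≢lo ∘ sym)) (simpleRoot-other (suc n) (t≢hi ∘ sym))))

    pairing-centre : ∀ f → pairing n (inj₂ j) f ≡ pairing (suc n) lo (stretch j f) + pairing (suc n) hi (stretch j f)
    pairing-centre f =
      begin
        offPath (inj₂ j) f + sumFin (suc n) (λ q → pathEntry (toℕ j) (toℕ q) * h q)
      ≡⟨ cong₂ _+_ (sym off-split) (pathEntry-sum n j h) ⟩
        (offPath lo F + offPath hi F) + (+ 2 * c - l - r)
      ≡⟨ regroup (offPath lo F) (offPath hi F) c l r ⟩
        (offPath lo F + (+ 2 * c - l - c)) + (offPath hi F + (+ 2 * c - c - r))
      ≡⟨ sym (cong₂ _+_ (cong (_+_ (offPath lo F)) path-lo) (cong (_+_ (offPath hi F)) path-hi)) ⟩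
        pairing (suc n) lo F + pairing (suc n) hi F
      ∎
      where
      open ≡-Reasoning
      offPath : ∀ {m} → V D m → (V D m → ℤ) → ℤ
      offPath {m} v g = sumFin k (λ i → stA D m v (inj₁ i) * g (inj₁ i))
      F = stretch j f
      h = f ∘ inj₂
      c = h j
      l = leftOf j h
      r = rightOf n j h
      off-split : offPath lo F + offPath hi F ≡ offPath (inj₂ j) f
      off-split = trans (sym (sumFin-+-* k (λ i → stA D (suc n) lo (inj₁ i)) (λ i → stA D (suc n) hi (inj₁ i)) (f ∘ inj₁)))
                        (sumFin-cong k (λ i → cong (_* f (inj₁ i)) (stA-offPath-split i)))
      path-lo : sumFin (suc (suc n)) (λ q → pathEntry (toℕ (inject₁ j)) (toℕ q) * h (pinch j q)) ≡ + 2 * c - l - c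
      path-lo = trans (pathEntry-sum (suc n) (inject₁ j) (h ∘ pinch j))
        (cong₃ (λ x y z → + 2 * x - y - z) (cong h (pinch-inject₁ j)) (left-inject₁ j h) (right-inject₁ j h))
      path-hi : sumFin (suc (suc n)) (λ q → pathEntry (toℕ (suc j)) (toℕ q) * h (pinch j q)) ≡ + 2 * c - c - r
      path-hi = trans (pathEntry-sum (suc n) (suc j) (h ∘ pinch j))
        (cong₃ (λ x y z → + 2 * x - y - z) (cong h (pinch-suc j)) (left-suc j h) (right-suc j h))
      regroup : ∀ a b c l r → a + b + (+ 2 * c - l - r) ≡ (a + (+ 2 * c - l - c)) + (b + (+ 2 * c - c - r))
      regroup = solve-∀

    stretch-simpleRoot : ∀ t → stretch j (simpleRoot D n (inj₂ j)) t ≡ reflection D (suc n) lo (simpleRoot D (suc n) hi) t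
    stretch-simpleRoot t =
      begin
        stretch j (simpleRoot D n (inj₂ j)) t
      ≡⟨ stretch-simpleRoot-centre t ⟩
        simpleRoot D (suc n) lo t + simpleRoot D (suc n) hi t
      ≡⟨ swap (simpleRoot D (suc n) lo t) (simpleRoot D (suc n) hi t) ⟩
        simpleRoot D (suc n) hi t - - 1ℤ * simpleRoot D (suc n) lo t
      ≡⟨ cong (λ a → simpleRoot D (suc n) hi t - a * simpleRoot D (suc n) lo t)
              (sym (trans (pairing-simpleRoot (suc n) lo hi) stA-lo-hi)) ⟩
        simpleRoot D (suc n) hi t - pairing (suc n) lo (simpleRoot D (suc n) hi) * simpleRoot D (suc n) lo t
      ≡⟨ sym (reflection-≡ (suc n) lo (simpleRoot D (suc n) hi) t) ⟩
        reflection D (suc n) lo (simpleRoot D (suc n) hi) t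
      ∎
      where
      open ≡-Reasoning
      swap : ∀ a b → a + b ≡ b - - 1ℤ * a
      swap = solve-∀

    stretch-reflection : ∀ f t → stretch j (reflection D n (inj₂ j) f) t
                               ≡ reflection D (suc n) lo (reflection D (suc n) hi (reflection D (suc n) lo (stretch j f))) t
    stretch-reflection f t =
      begin
        reflection D n (inj₂ j) f (squash j t)
      ≡⟨ reflection-≡ n (inj₂ j) f (squash j t) ⟩
        f (squash j t) - pairing n (inj₂ j) f * simpleRoot D n (inj₂ j) (squash j t)
      ≡⟨ cong₂ (λ a b → f (squash j t) - a * b) (pairing-centre f) (stretch-simpleRoot-centre t) ⟩
        stretch j f t - (pairing (suc n) lo (stretch j f) + pairing (suc n) hi (stretch j f))
                        * (simpleRoot D (suc n) lo t + simpleRoot D (suc n) hi t)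
      ≡⟨ sym (reflection-braid (suc n) lo hi (stretch j f) stA-lo-lo stA-lo-hi stA-hi-lo t) ⟩
        reflection D (suc n) lo (reflection D (suc n) hi (reflection D (suc n) lo (stretch j f))) t
      ∎
      where open ≡-Reasoning

  data Fibre {n} (j : Fin (suc n)) : V D n → Set where
    lifted : ∀ {v} v′ → UniqueLift j v v′ → Fibre j v
    centre : Fibre j (inj₂ j)

  fibre : ∀ {n} (j : Fin (suc n)) v → Fibre j v
  fibre j (inj₁ i) = lifted (inj₁ i) (lift-offPath j i)
  fibre j (inj₂ p) with p Fin.≟ j
  ... | yes refl = centre
  ... | no p≢j   = lifted _ (lift-path j p p≢j)

  stretch-root : ∀ {n} (j : Fin (suc n)) {f} → IsRootF D n f → IsRootF D (suc n) (stretch j f)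
  stretch-root j (simple v f≗α) with fibre j v
  ... | lifted v′ lift = simple v′ (λ t → trans (f≗α _) (stretch-simpleRoot-lift lift t))
  ... | centre         = reflect lo (simple hi λ _ → refl) (λ t → trans (f≗α _) (stretch-simpleRoot t))
    where open Centre j
  stretch-root j (reflect v r h≗sf) with fibre j v
  ... | lifted v′ lift = reflect v′ (stretch-root j r) (λ t → trans (h≗sf _) (stretch-reflection-lift lift _ t))
  ... | centre         = reflect lo (reflect hi (reflect lo (stretch-root j r) λ _ → refl) λ _ → refl)
                                 (λ t → trans (h≗sf _) (stretch-reflection _ t))
    where open Centre j

  IsRoot-cong : ∀ {g g′ : Fin k → ℤ} w → (∀ i → g i ≡ g′ i) → IsRoot D g w → IsRoot D g′ w
  IsRoot-cong (v ∷ vs) g≗g′ r = root-cong r λ { (inj₁ i) → g≗g′ i ; (inj₂ q) → refl }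

  vertexValues : (Fin k → ℤ) → List ℤ → ∀ m → V D m → ℤ
  vertexValues g w m = [ g , (λ q → valueAt w (toℕ q)) ]

  IsRoot⇒IsRootF : ∀ g w m → length w ≡ suc m → IsRoot D g w → IsRootF D m (vertexValues g w m)
  IsRoot⇒IsRootF g (v ∷ vs) _ refl r = root-cong r λ { (inj₁ i) → refl ; (inj₂ q) → lookup-valueAt (v ∷ vs) q }

  IsRootF⇒IsRoot : ∀ g w m → length w ≡ suc m → IsRootF D m (vertexValues g w m) → IsRoot D g w
  IsRootF⇒IsRoot g (v ∷ vs) _ refl r = root-cong r λ { (inj₁ i) → refl ; (inj₂ q) → sym (lookup-valueAt (v ∷ vs) q) }

  root-duplicate : ∀ g P c B → IsRoot D g (P ++ c ∷ B) → IsRoot D g (P ++ c ∷ c ∷ B)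
  root-duplicate g P c B r =
    IsRootF⇒IsRoot g (P ++ c ∷ c ∷ B) (suc m)
      (trans (length-++-∷ P c (c ∷ B)) (cong suc (ℕₚ.+-suc (length P) (length B))))
      (root-cong (stretch-root (position P (length B)) (IsRoot⇒IsRootF g (P ++ c ∷ B) m (length-++-∷ P c B) r))
                 λ { (inj₁ i) → refl ; (inj₂ q) → valueAt-pinch P c B q })
    where m = length P ℕ.+ length B

  root-replicate : ∀ g P c B → IsRoot D g (P ++ c ∷ B) → ∀ m → IsRoot D g (P ++ replicate (suc m) c ++ B)
  root-replicate g P c B r zero    = r
  root-replicate g P c B r (suc m) = root-duplicate g P c (replicate m c ++ B) (root-replicate g P c B r m)

  root-expand : ∀ g P M S → IsRoot D g (P ++ M ++ S) → ∀ ms → IsRoot D g (P ++ expand D M ms ++ S)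
  root-expand g P []      S r Vec.[]         = r
  root-expand g P (c ∷ M) S r (m Vec.∷ ms) =
    subst (IsRoot D g) reassoc
      (root-expand g (P ++ run) M S (subst (IsRoot D g) (sym (Listₚ.++-assoc P run (M ++ S))) (root-replicate g P c (M ++ S) r m)) ms)
    where
    run = replicate (suc m) c
    reassoc : (P ++ run) ++ expand D M ms ++ S ≡ P ++ (run ++ expand D M ms) ++ S
    reassoc = trans (Listₚ.++-assoc P run _) (cong (P ++_) (sym (Listₚ.++-assoc run (expand D M ms) S)))

-- Run patterns and their languages

-- A slot (c , n , b) stands for a run of the letter c of length exactly suc n (b = false) or at
-- least suc n (b = true).
Constraint : Set
Constraint = ℕ × Bool

Fits : ℕ → Constraint → Set
Fits k (n , false) = k ≡ n
Fits k (n , true)  = n ≤ k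

Slot : Set
Slot = ℤ × Constraint

Lang : List Slot → List ℤ → Set
Lang []              w = w ≡ []
Lang ((c , γ) ∷ Q) w = Σ ℕ λ k → Fits k γ × Σ (List ℤ) λ v → w ≡ replicate (suc k) c ++ v × Lang Q v

Reduced : List Slot → Set
Reduced = Linked (λ e f → proj₁ e ≢ proj₁ f)

replicate-++ : ∀ a b (c : ℤ) X → replicate a c ++ replicate b c ++ X ≡ replicate (a ℕ.+ b) c ++ X
replicate-++ zero    b c X = refl
replicate-++ (suc a) b c X = cong (c ∷_) (replicate-++ a b c X)

fits⇒≤ : ∀ {k} γ → Fits k γ → proj₁ γ ≤ k
fits⇒≤ (n , false) refl = ℕₚ.≤-refl
fits⇒≤ (n , true)  n≤k  = n≤k

fits-refl : ∀ n b → Fits n (n , b)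
fits-refl n false = refl
fits-refl n true  = ℕₚ.≤-refl

merge : Constraint → Constraint → Constraint
merge (n , b) (m , b′) = n ℕ.+ suc m , b ∨ b′

fits-merge : ∀ {k₁ k₂} γ δ → Fits k₁ γ → Fits k₂ δ → Fits (k₁ ℕ.+ suc k₂) (merge γ δ)
fits-merge (n , false) (m , false) refl refl = refl
fits-merge (n , false) (m , true)  f₁   f₂   = ℕₚ.+-mono-≤ (fits⇒≤ (n , false) f₁) (s≤s f₂)
fits-merge (n , true)  δ           f₁   f₂   = ℕₚ.+-mono-≤ f₁ (s≤s (fits⇒≤ δ f₂))

fits-split : ∀ {k} γ δ → Fits k (merge γ δ) →
  Σ ℕ λ k₁ → Σ ℕ λ k₂ → k ≡ k₁ ℕ.+ suc k₂ × Fits k₁ γ × Fits k₂ δ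
fits-split (n , false) (m , false) refl = n , m , refl , refl , refl
fits-split {k} (n , false) (m , true) le =
  n , k ∸ suc n , sym (trans (ℕₚ.+-suc n _) (ℕₚ.m+[n∸m]≡n (ℕₚ.m+n≤o⇒m≤o (suc n) le′))) , refl ,
  ℕₚ.m+n≤o⇒m≤o∸n m (subst (_≤ k) (ℕₚ.+-comm (suc n) m) le′)
  where
  le′ : suc n ℕ.+ m ≤ k
  le′ = subst (_≤ k) (ℕₚ.+-suc n m) le
fits-split {k} (n , true) (m , b′) le =
  k ∸ suc m , m , sym (ℕₚ.m∸n+n≡m (ℕₚ.m+n≤o⇒n≤o n le)) , ℕₚ.m+n≤o⇒m≤o∸n n le , fits-refl m b′

Lang-merge : ∀ c γ δ Q w → Lang ((c , γ) ∷ (c , δ) ∷ Q) w ⇔ Lang ((c , merge γ δ) ∷ Q) w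
Lang-merge c γ δ Q w = mk⇔ to from
  where
  to : Lang ((c , γ) ∷ (c , δ) ∷ Q) w → Lang ((c , merge γ δ) ∷ Q) w
  to (k₁ , f₁ , _ , refl , k₂ , f₂ , v , refl , l) =
    k₁ ℕ.+ suc k₂ , fits-merge γ δ f₁ f₂ , v , replicate-++ (suc k₁) (suc k₂) c v , l
  from : Lang ((c , merge γ δ) ∷ Q) w → Lang ((c , γ) ∷ (c , δ) ∷ Q) w
  from (k , f , v , refl , l) with fits-split γ δ f
  ... | k₁ , k₂ , refl , f₁ , f₂ =
    k₁ , f₁ , replicate (suc k₂) c ++ v , sym (replicate-++ (suc k₁) (suc k₂) c v) , k₂ , f₂ , v , refl , l

Lang-∷-cong : ∀ e {Q Q′} → (∀ v → Lang Q v ⇔ Lang Q′ v) → ∀ w → Lang (e ∷ Q) w ⇔ Lang (e ∷ Q′) w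
Lang-∷-cong (c , γ) Q⇔Q′ w = mk⇔
  (λ (k , f , v , eq , l) → k , f , v , eq , Equivalence.to (Q⇔Q′ v) l)
  (λ (k , f , v , eq , l) → k , f , v , eq , Equivalence.from (Q⇔Q′ v) l)

push : Slot → List Slot → List Slot
push e              []             = e ∷ []
push (c , γ) ((d , δ) ∷ Q) with c ℤ.≟ d
... | yes _ = (d , merge γ δ) ∷ Q
... | no  _ = (c , γ) ∷ (d , δ) ∷ Q

normalise : List Slot → List Slot
normalise = List.foldr push []

Lang-push : ∀ e Q w → Lang (push e Q) w ⇔ Lang (e ∷ Q) w
Lang-push e             []             w = ⇔.refl
Lang-push (c , γ) ((d , δ) ∷ Q) w with c ℤ.≟ d
... | yes refl = ⇔.sym (Lang-merge c γ δ Q w)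
... | no  _    = ⇔.refl

Lang-foldr-push : ∀ T Q w → Lang (List.foldr push Q T) w ⇔ Lang (T ++ Q) w
Lang-foldr-push []      Q w = ⇔.refl
Lang-foldr-push (e ∷ T) Q w =
  ⇔.trans (Lang-push e (List.foldr push Q T) w) (Lang-∷-cong e (Lang-foldr-push T Q) w)

Reduced-push : ∀ e Q → Reduced Q → Reduced (push e Q)
Reduced-push e             []             _ = [-]
Reduced-push (c , γ) ((d , δ) ∷ Q) r with c ℤ.≟ d
... | yes _   = relabel r
  where
  relabel : ∀ {δ′} → Reduced ((d , δ) ∷ Q) → Reduced ((d , δ′) ∷ Q)
  relabel [-]       = [-]
  relabel (d≢ ∷ r′) = d≢ ∷ r′
... | no  c≢d = c≢d ∷ r

Reduced-foldr-push : ∀ T Q → Reduced Q → Reduced (List.foldr push Q T)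
Reduced-foldr-push []      Q r = r
Reduced-foldr-push (e ∷ T) Q r = Reduced-push e _ (Reduced-foldr-push T Q r)

HeadNot : ℤ → List ℤ → Set
HeadNot c []      = ⊤
HeadNot c (d ∷ _) = d ≢ c

Lang-head : ∀ {c γ Q v} → Reduced ((c , γ) ∷ Q) → Lang Q v → HeadNot c v
Lang-head {Q = []}          _         refl                   = tt
Lang-head {Q = (d , δ) ∷ Q} (c≢d ∷ _) (_ , _ , _ , refl , _) = c≢d ∘ sym

replicate-cancel : ∀ {c : ℤ} k l {X Y} → HeadNot c X → HeadNot c Y →
  replicate (suc k) c ++ X ≡ replicate (suc l) c ++ Y → k ≡ l × X ≡ Y
replicate-cancel zero    zero    _  _  eq = refl , Listₚ.∷-injectiveʳ eq
replicate-cancel zero    (suc l) {X = []}    _  _  ()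
replicate-cancel zero    (suc l) {X = d ∷ X} hX _  eq = ⊥-elim (hX (Listₚ.∷-injectiveˡ (Listₚ.∷-injectiveʳ eq)))
replicate-cancel (suc k) zero    {Y = []}    _  _  ()
replicate-cancel (suc k) zero    {Y = d ∷ Y} _  hY eq = ⊥-elim (hY (sym (Listₚ.∷-injectiveˡ (Listₚ.∷-injectiveʳ eq))))
replicate-cancel (suc k) (suc l) hX hY eq with replicate-cancel k l hX hY (Listₚ.∷-injectiveʳ eq)
... | refl , X≡Y = refl , X≡Y

Lang-∷-agree : ∀ {c d γ δ Q₁ Q₂ w} → Reduced ((c , γ) ∷ Q₁) → Reduced ((d , δ) ∷ Q₂) →
  Lang ((c , γ) ∷ Q₁) w → Lang ((d , δ) ∷ Q₂) w →
  c ≡ d × Σ ℕ λ k → Fits k γ × Fits k δ × Σ (List ℤ) λ v → w ≡ replicate (suc k) c ++ v × Lang Q₁ v × Lang Q₂ v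
Lang-∷-agree r₁ r₂ (k , f₁ , v , refl , l₁) (k′ , f₂ , v′ , eq , l₂) with Listₚ.∷-injectiveˡ eq
... | refl with replicate-cancel k k′ (Lang-head r₁ l₁) (Lang-head r₂ l₂) eq
... | refl , refl = refl , k , f₁ , f₂ , v , refl , l₁ , l₂

data Meet₁ : Constraint → Constraint → Constraint → Set where
  exact-exact     : ∀ {n}   → Meet₁ (n , false) (n , false) (n , false)
  exact-atLeast   : ∀ {n m} → m ≤ n → Meet₁ (n , false) (m , true) (n , false)
  atLeast-exact   : ∀ {n m} → n ≤ m → Meet₁ (n , true) (m , false) (m , false)
  atLeast-atLeast : ∀ {n m} → Meet₁ (n , true) (m , true) (n ⊔ m , true)

fits-meet : ∀ {γ δ ε k} → Meet₁ γ δ ε → Fits k γ → Fits k δ → Fits k ε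
fits-meet exact-exact       f₁ f₂ = f₁
fits-meet (exact-atLeast _) f₁ f₂ = f₁
fits-meet (atLeast-exact _) f₁ f₂ = f₂
fits-meet atLeast-atLeast   f₁ f₂ = ℕₚ.⊔-lub f₁ f₂

fits-meet⁻ : ∀ {γ δ ε k} → Meet₁ γ δ ε → Fits k ε → Fits k γ × Fits k δ
fits-meet⁻ exact-exact          f    = f , f
fits-meet⁻ (exact-atLeast m≤n)  refl = refl , m≤n
fits-meet⁻ (atLeast-exact n≤m)  refl = n≤m , refl
fits-meet⁻ (atLeast-atLeast {n} {m}) f =
  ℕₚ.≤-trans (ℕₚ.m≤m⊔n n m) f , ℕₚ.≤-trans (ℕₚ.m≤n⊔m n m) f

meet₁? : ∀ γ δ → (Σ Constraint λ ε → Meet₁ γ δ ε) ⊎ (∀ k → Fits k γ → Fits k δ → ⊥)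
meet₁? (n , false) (m , false) with n ℕ.≟ m
... | yes refl = inj₁ (_ , exact-exact)
... | no  n≢m  = inj₂ λ { _ refl refl → n≢m refl }
meet₁? (n , false) (m , true) with m ℕ.≤? n
... | yes m≤n = inj₁ (_ , exact-atLeast m≤n)
... | no  m≰n = inj₂ λ { _ refl m≤n → m≰n m≤n }
meet₁? (n , true) (m , false) with n ℕ.≤? m
... | yes n≤m = inj₁ (_ , atLeast-exact n≤m)
... | no  n≰m = inj₂ λ { _ n≤m refl → n≰m n≤m }
meet₁? (n , true) (m , true) = inj₁ (_ , atLeast-atLeast)

data Meet : List Slot → List Slot → List Slot → Set where
  []  : Meet [] [] []
  _∷_ : ∀ {c γ δ ε Q₁ Q₂ Q₃} → Meet₁ γ δ ε → Meet Q₁ Q₂ Q₃ → Meet ((c , γ) ∷ Q₁) ((c , δ) ∷ Q₂) ((c , ε) ∷ Q₃)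

Reduced-meet : ∀ {Q₁ Q₂ Q₃} → Meet Q₁ Q₂ Q₃ → Reduced Q₁ → Reduced Q₃
Reduced-meet []                  r         = []
Reduced-meet (_ ∷ [])            r         = [-]
Reduced-meet (_ ∷ m@(_ ∷ _))     (c≢ ∷ r)  = c≢ ∷ Reduced-meet m r

Lang-meet : ∀ {Q₁ Q₂ Q₃ w} → Meet Q₁ Q₂ Q₃ → Reduced Q₁ → Reduced Q₂ → Lang Q₁ w → Lang Q₂ w → Lang Q₃ w
Lang-meet []       r₁ r₂ l₁ l₂ = l₁
Lang-meet (μ ∷ m) r₁ r₂ l₁ l₂ with Lang-∷-agree r₁ r₂ l₁ l₂
... | _ , k , f₁ , f₂ , v , eq , l₁′ , l₂′ =
  k , fits-meet μ f₁ f₂ , v , eq , Lang-meet m (Linked.tail r₁) (Linked.tail r₂) l₁′ l₂′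

Lang-meet⁻ : ∀ {Q₁ Q₂ Q₃ w} → Meet Q₁ Q₂ Q₃ → Lang Q₃ w → Lang Q₁ w × Lang Q₂ w
Lang-meet⁻ []       l                    = l , l
Lang-meet⁻ (μ ∷ m) (k , f , v , eq , l) =
  (k , proj₁ (fits-meet⁻ μ f) , v , eq , proj₁ (Lang-meet⁻ m l)) ,
  (k , proj₂ (fits-meet⁻ μ f) , v , eq , proj₂ (Lang-meet⁻ m l))

meet? : ∀ Q₁ Q₂ → Reduced Q₁ → Reduced Q₂ → (Σ (List Slot) λ Q₃ → Meet Q₁ Q₂ Q₃) ⊎ (∀ w → Lang Q₁ w → Lang Q₂ w → ⊥)
meet? []              []              _  _  = inj₁ ([] , [])
meet? []              ((d , δ) ∷ Q₂)  _  _  = inj₂ λ { _ refl (_ , _ , _ , () , _) }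
meet? ((c , γ) ∷ Q₁)  []              _  _  = inj₂ λ { _ (_ , _ , _ , () , _) refl }
meet? ((c , γ) ∷ Q₁)  ((d , δ) ∷ Q₂)  r₁ r₂ with c ℤ.≟ d | meet₁? γ δ | meet? Q₁ Q₂ (Linked.tail r₁) (Linked.tail r₂)
... | no c≢d     | _              | _              = inj₂ λ w l₁ l₂ → c≢d (proj₁ (Lang-∷-agree r₁ r₂ l₁ l₂))
... | yes refl   | inj₂ disjoint  | _              = inj₂ λ w l₁ l₂ →
  let (_ , k , f₁ , f₂ , _) = Lang-∷-agree r₁ r₂ l₁ l₂ in disjoint k f₁ f₂
... | yes refl   | inj₁ _         | inj₂ disjoint  = inj₂ λ w l₁ l₂ →
  let (_ , _ , _ , _ , v , _ , l₁′ , l₂′) = Lang-∷-agree r₁ r₂ l₁ l₂ in disjoint v l₁′ l₂′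
... | yes refl   | inj₁ (ε , μ)   | inj₁ (Q₃ , m)  = inj₁ ((c , ε) ∷ Q₃ , μ ∷ m)

-- The shape of a stretching pattern

-- Reading a pattern from the left: before the block of bounded runs, inside it (where an interior
-- run must have minimal length one), or after it.
data Phase : Set where
  before inside after : Phase

close : Phase → Phase
close before = before
close inside = after
close after  = after

Open : Phase → Set
Open after = ⊥
Open _     = ⊤

enter : Phase → ℕ → Phase
enter before n       = inside
enter inside zero    = inside
enter inside (suc n) = after
enter after  n       = after

Shaped : Phase → List Slot → Set
Shaped s      []                       = ⊤
Shaped s      ((_ , _ , false) ∷ Q)    = Shaped (close s) Q
Shaped before ((_ , n , true) ∷ Q)     = Shaped (enter before n) Q
Shaped inside ((_ , n , true) ∷ Q)     = Shaped (enter inside n) Q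
Shaped after  ((_ , _ , true) ∷ Q)     = ⊥

Shaped-flexible⁻ : ∀ s c n Q → Shaped s ((c , n , true) ∷ Q) → Open s × Shaped (enter s n) Q
Shaped-flexible⁻ before c n Q sh = tt , sh
Shaped-flexible⁻ inside c n Q sh = tt , sh

Shaped-flexible⁺ : ∀ s c n Q → Open s → Shaped (enter s n) Q → Shaped s ((c , n , true) ∷ Q)
Shaped-flexible⁺ before c n Q _ sh = sh
Shaped-flexible⁺ inside c n Q _ sh = sh

_⊑_ : Phase → Phase → Set
after  ⊑ _      = ⊤
inside ⊑ inside = ⊤
inside ⊑ before = ⊤
before ⊑ before = ⊤
_      ⊑ _      = ⊥

Shaped-after : ∀ s Q → Shaped after Q → Shaped s Q
Shaped-after s []                         sh = tt
Shaped-after s ((_ , _ , false) ∷ Q)      sh = Shaped-after (close s) Q sh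
Shaped-after s ((_ , _ , true) ∷ Q)       ()

Shaped-weaken : ∀ {s t} Q → s ⊑ t → Shaped s Q → Shaped t Q
Shaped-weaken {after}                Q                          _ sh = Shaped-after _ Q sh
Shaped-weaken {inside} {inside}      Q                          _ sh = sh
Shaped-weaken {before} {before}      Q                          _ sh = sh
Shaped-weaken {inside} {before}      []                         _ sh = tt
Shaped-weaken {inside} {before}      ((_ , _ , false) ∷ Q)      _ sh = Shaped-after before Q sh
Shaped-weaken {inside} {before}      ((_ , zero , true) ∷ Q)    _ sh = sh
Shaped-weaken {inside} {before}      ((_ , suc n , true) ∷ Q)   _ sh = Shaped-after inside Q sh

_⊓_ : Phase → Phase → Phase
after  ⊓ _      = after
_      ⊓ after  = after
before ⊓ _      = before
inside ⊓ before = before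
inside ⊓ inside = inside

⊓-close : ∀ s t → (close s ⊓ close t) ⊑ close (s ⊓ t)
⊓-close before before = tt
⊓-close before inside = tt
⊓-close before after  = tt
⊓-close inside before = tt
⊓-close inside inside = tt
⊓-close inside after  = tt
⊓-close after  t      = tt

⊓-close-enter : ∀ s t n → Open t → (close s ⊓ enter t n) ⊑ close (s ⊓ t)
⊓-close-enter before before n       _ = tt
⊓-close-enter before inside zero    _ = tt
⊓-close-enter before inside (suc n) _ = tt
⊓-close-enter inside before n       _ = tt
⊓-close-enter inside inside zero    _ = tt
⊓-close-enter inside inside (suc n) _ = tt
⊓-close-enter after  before n       _ = tt
⊓-close-enter after  inside n       _ = tt

⊓-enter-close : ∀ s t n → Open s → (enter s n ⊓ close t) ⊑ close (s ⊓ t)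
⊓-enter-close before before n       _ = tt
⊓-enter-close before inside n       _ = tt
⊓-enter-close before after  n       _ = tt
⊓-enter-close inside before zero    _ = tt
⊓-enter-close inside before (suc n) _ = tt
⊓-enter-close inside inside zero    _ = tt
⊓-enter-close inside inside (suc n) _ = tt
⊓-enter-close inside after  zero    _ = tt
⊓-enter-close inside after  (suc n) _ = tt

⊓-enter : ∀ s t m n → Open s → Open t → (enter s m ⊓ enter t n) ⊑ enter (s ⊓ t) (m ⊔ n)
⊓-enter before before m       n       _ _ = tt
⊓-enter before inside m       zero    _ _ = tt
⊓-enter before inside m       (suc n) _ _ = tt
⊓-enter inside before zero    n       _ _ = tt
⊓-enter inside before (suc m) n       _ _ = tt
⊓-enter inside inside zero    zero    _ _ = tt
⊓-enter inside inside zero    (suc n) _ _ = tt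
⊓-enter inside inside (suc m) zero    _ _ = tt
⊓-enter inside inside (suc m) (suc n) _ _ = tt

⊓-open : ∀ s t → Open s → Open t → Open (s ⊓ t)
⊓-open before before _ _ = tt
⊓-open before inside _ _ = tt
⊓-open inside before _ _ = tt
⊓-open inside inside _ _ = tt

Shaped-meet : ∀ {Q₁ Q₂ Q₃} s t → Meet Q₁ Q₂ Q₃ → Shaped s Q₁ → Shaped t Q₂ → Shaped (s ⊓ t) Q₃
Shaped-meet s t [] _ _ = tt
Shaped-meet {_ ∷ Q₁} {_ ∷ Q₂} {_ ∷ Q₃} s t (exact-exact ∷ m) sh₁ sh₂ =
  Shaped-weaken Q₃ (⊓-close s t) (Shaped-meet (close s) (close t) m sh₁ sh₂)
Shaped-meet {_ ∷ Q₁} {(c , n , _) ∷ Q₂} {_ ∷ Q₃} s t (exact-atLeast _ ∷ m) sh₁ sh₂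
  with Shaped-flexible⁻ t c n Q₂ sh₂
... | open-t , sh₂′ = Shaped-weaken Q₃ (⊓-close-enter s t n open-t) (Shaped-meet (close s) (enter t n) m sh₁ sh₂′)
Shaped-meet {(c , n , _) ∷ Q₁} {_ ∷ Q₂} {_ ∷ Q₃} s t (atLeast-exact _ ∷ m) sh₁ sh₂
  with Shaped-flexible⁻ s c n Q₁ sh₁
... | open-s , sh₁′ = Shaped-weaken Q₃ (⊓-enter-close s t n open-s) (Shaped-meet (enter s n) (close t) m sh₁′ sh₂)
Shaped-meet {(c , m₁ , _) ∷ Q₁} {(_ , m₂ , _) ∷ Q₂} {_ ∷ Q₃} s t (atLeast-atLeast ∷ m) sh₁ sh₂
  with Shaped-flexible⁻ s c m₁ Q₁ sh₁ | Shaped-flexible⁻ t c m₂ Q₂ sh₂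
... | open-s , sh₁′ | open-t , sh₂′ =
  Shaped-flexible⁺ (s ⊓ t) c (m₁ ⊔ m₂) Q₃ (⊓-open s t open-s open-t)
    (Shaped-weaken Q₃ (⊓-enter s t m₁ m₂ open-s open-t) (Shaped-meet (enter s m₁) (enter t m₂) m sh₁′ sh₂′))

once : List ℤ → List Slot
once = List.map (λ c → c , 0 , false)

some : List ℤ → List Slot
some = List.map (λ c → c , 0 , true)

push-once-Shaped : ∀ s c Q → close s ≡ s → Shaped s Q → Shaped s (push (c , 0 , false) Q)
push-once-Shaped s c [] _ _ = tt
push-once-Shaped s c ((d , m , b) ∷ Q) closed sh with c ℤ.≟ d
push-once-Shaped s      c ((d , m , false) ∷ Q) closed sh | yes _ = sh
push-once-Shaped before c ((d , m , true) ∷ Q)  closed sh | yes _ = sh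
push-once-Shaped inside c ((d , m , true) ∷ Q)  ()     sh | yes _
push-once-Shaped after  c ((d , m , true) ∷ Q)  closed () | yes _
... | no _ = subst (λ s′ → Shaped s′ ((d , m , b) ∷ Q)) (sym closed) sh

foldr-once-Shaped : ∀ s P Q → close s ≡ s → Shaped s Q → Shaped s (List.foldr push Q (once P))
foldr-once-Shaped s []      Q closed sh = sh
foldr-once-Shaped s (c ∷ P) Q closed sh = push-once-Shaped s c (List.foldr push Q (once P)) closed (foldr-once-Shaped s P Q closed sh)

foldr-some-Shaped : ∀ c M Q → Linked _≢_ (c ∷ M) → Shaped after Q →
  Σ ℕ λ n → Σ (List Slot) λ Q′ → List.foldr push Q (some (c ∷ M)) ≡ (c , n , true) ∷ Q′ × Shaped inside ((c , n , true) ∷ Q′)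
foldr-some-Shaped c [] [] _ _ = 0 , [] , refl , tt
foldr-some-Shaped c [] ((d , m , b) ∷ Q) _ sh with c ℤ.≟ d
foldr-some-Shaped c [] ((d , m , false) ∷ Q) _ sh | yes refl = suc m , Q , refl , sh
foldr-some-Shaped c [] ((d , m , true)  ∷ Q) _ () | yes refl
... | no _ = 0 , (d , m , b) ∷ Q , refl , Shaped-after inside ((d , m , b) ∷ Q) sh
foldr-some-Shaped c (c′ ∷ M) Q (c≢c′ ∷ linked) sh with foldr-some-Shaped c′ M Q linked sh
... | n , Q′ , eq , sh′ rewrite eq with c ℤ.≟ c′
... | yes c≡c′ = ⊥-elim (c≢c′ c≡c′)
... | no _     = 0 , (c′ , n , true) ∷ Q′ , refl , sh′

normalise-class-Shaped : ∀ P c M S → Linked _≢_ (c ∷ M) → Shaped before (normalise (once P ++ some (c ∷ M) ++ once S))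
normalise-class-Shaped P c M S linked
  with foldr-some-Shaped c M (normalise (once S)) linked (foldr-once-Shaped after S [] refl tt)
... | n , Q′ , eq , sh =
  subst (Shaped before)
        (sym (trans (Listₚ.foldr-++ push [] (once P) _) (cong (λ Q → List.foldr push Q (once P)) (trans (Listₚ.foldr-++ push [] (some (c ∷ M)) _) eq))))
        (foldr-once-Shaped before P _ refl (Shaped-weaken {inside} {before} ((c , n , true) ∷ Q′) tt sh))

fixedWord : List Slot → List ℤ
fixedWord []                  = []
fixedWord ((c , n , _) ∷ Q) = replicate (suc n) c ++ fixedWord Q

Lang-after : ∀ Q w → Shaped after Q → Lang Q w ⇔ w ≡ fixedWord Q
Lang-after []                    w _  = ⇔.refl
Lang-after ((c , n , false) ∷ Q) w sh = mk⇔
  (λ { (_ , refl , v , refl , l) → cong (replicate (suc n) c ++_) (Equivalence.to (Lang-after Q v sh) l) })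
  (λ { refl → n , refl , fixedWord Q , refl , Equivalence.from (Lang-after Q (fixedWord Q) sh) refl })

Lang-fixed : ∀ c n Q w → Lang ((c , n , false) ∷ Q) w ⇔ (Σ (List ℤ) λ v → w ≡ replicate (suc n) c ++ v × Lang Q v)
Lang-fixed c n Q w = mk⇔ (λ { (_ , refl , v , eq , l) → v , eq , l }) (λ (v , eq , l) → n , refl , v , eq , l)

Lang-flexible : ∀ c n Q w → Lang ((c , n , true) ∷ Q) w ⇔
  (Σ ℕ λ m → Σ (List ℤ) λ v → w ≡ replicate (suc m) c ++ replicate n c ++ v × Lang Q v)
Lang-flexible c n Q w = mk⇔
  (λ (k , n≤k , v , eq , l) → k ∸ n , v ,
     trans eq (trans (cong (λ j → replicate (suc j) c ++ v) (sym (ℕₚ.m∸n+n≡m n≤k)))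
                     (sym (replicate-++ (suc (k ∸ n)) n c v))) , l)
  (λ (m , v , eq , l) → m ℕ.+ n , ℕₚ.m≤n+m n m , v , trans eq (replicate-++ (suc m) n c v) , l)

module StretchingWords (D : ElasticCartan) where

  Stretching : List ℤ → List ℤ → List ℤ → List ℤ → Set
  Stretching P M S w = Σ (Vec ℕ (List.length M)) λ ms → w ≡ P ++ expand D M ms ++ S

  expand-zeros : ∀ (M : List ℤ) → expand D M (Vec.replicate (length M) 0) ≡ M
  expand-zeros []      = refl
  expand-zeros (c ∷ M) = cong (c ∷_) (expand-zeros M)

  data Trichotomy (L : List ℤ → Set) : Set where
    empty      : (∀ w → ¬ L w) → Trichotomy L
    singleton  : ∀ w₀ → (∀ w → L w ⇔ w ≡ w₀) → Trichotomy L
    stretching : ∀ P c M S → Linked _≢_ (c ∷ M) → (∀ w → L w ⇔ Stretching P (c ∷ M) S w) → Trichotomy L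

  Trichotomy-resp : ∀ {L L′} → (∀ w → L w ⇔ L′ w) → Trichotomy L → Trichotomy L′
  Trichotomy-resp L⇔L′ (empty ∅)                     = empty λ w → ∅ w ∘ Equivalence.from (L⇔L′ w)
  Trichotomy-resp L⇔L′ (singleton w₀ eqv)            = singleton w₀ λ w → ⇔.trans (⇔.sym (L⇔L′ w)) (eqv w)
  Trichotomy-resp L⇔L′ (stretching P c M S lnk eqv)  = stretching P c M S lnk λ w → ⇔.trans (⇔.sym (L⇔L′ w)) (eqv w)

  Trichotomy-prefix : ∀ u {L} → Trichotomy L → Trichotomy (λ w → Σ (List ℤ) λ v → w ≡ u ++ v × L v)
  Trichotomy-prefix u (empty ∅) = empty λ { w (v , _ , l) → ∅ v l }
  Trichotomy-prefix u (singleton w₀ eqv) = singleton (u ++ w₀) λ w → mk⇔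
    (λ { (v , refl , l) → cong (u ++_) (Equivalence.to (eqv v) l) })
    (λ { refl → w₀ , refl , Equivalence.from (eqv w₀) refl })
  Trichotomy-prefix u (stretching P c M S lnk eqv) = stretching (u ++ P) c M S lnk λ w → mk⇔
    (λ { (v , refl , l) → let (ms , eq) = Equivalence.to (eqv v) l in
           ms , trans (cong (u ++_) eq) (sym (Listₚ.++-assoc u P _)) })
    (λ { (ms , refl) → P ++ expand D (c ∷ M) ms ++ S , Listₚ.++-assoc u P _ , Equivalence.from (eqv _) (ms , refl) })

  inside-form : ∀ c γ Q → Shaped inside Q → Reduced ((c , γ) ∷ Q) →
    Σ (List ℤ) λ M → Σ (List ℤ) λ S → Linked _≢_ (c ∷ M) × (∀ v → Lang Q v ⇔ Stretching [] M S v)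
  inside-form c γ [] _ _ = [] , [] , [-] , λ v → mk⇔ (λ { refl → Vec.[] , refl }) (λ { (Vec.[] , refl) → refl })
  inside-form c γ Q@((d , n , false) ∷ _) sh _ = [] , fixedWord Q , [-] , λ v →
    ⇔.trans (Lang-after Q v sh) (mk⇔ (λ eq → Vec.[] , eq) (λ { (Vec.[] , eq) → eq }))
  inside-form c γ ((d , zero , true) ∷ Q) sh (c≢d ∷ r) with inside-form d (zero , true) Q sh r
  ... | M , S , lnk , eqv = d ∷ M , S , c≢d ∷ lnk , λ v → ⇔.trans (Lang-flexible d zero Q v) (mk⇔
    (λ (m , v′ , eq , l) → let (ms , eq′) = Equivalence.to (eqv v′) l in
       m Vec.∷ ms , trans eq (trans (cong (replicate (suc m) d ++_) eq′) (sym (Listₚ.++-assoc (replicate (suc m) d) _ S))))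
    (λ { (m Vec.∷ ms , refl) → m , expand D M ms ++ S , Listₚ.++-assoc (replicate (suc m) d) _ S , Equivalence.from (eqv _) (ms , refl) }))
  inside-form c γ ((d , suc n , true) ∷ Q) sh (c≢d ∷ _) = d ∷ [] , replicate (suc n) d ++ fixedWord Q , c≢d ∷ [-] , λ v →
    ⇔.trans (Lang-flexible d (suc n) Q v) (mk⇔
      (λ (m , v′ , eq , l) → m Vec.∷ Vec.[] ,
         trans eq (cong₂ (λ x y → x ++ replicate (suc n) d ++ y) (sym (Listₚ.++-identityʳ (replicate (suc m) d))) (Equivalence.to (Lang-after Q v′ sh) l)))
      (λ { (m Vec.∷ Vec.[] , refl) → m , fixedWord Q ,
             cong (λ x → x ++ replicate (suc n) d ++ fixedWord Q) (Listₚ.++-identityʳ (replicate (suc m) d)) ,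
             Equivalence.from (Lang-after Q (fixedWord Q) sh) refl }))

  Shaped-trichotomy : ∀ Q → Shaped before Q → Reduced Q → Trichotomy (Lang Q)
  Shaped-trichotomy [] _ _ = singleton [] λ _ → ⇔.refl
  Shaped-trichotomy ((c , n , false) ∷ Q) sh r =
    Trichotomy-resp (λ w → ⇔.sym (Lang-fixed c n Q w))
      (Trichotomy-prefix (replicate (suc n) c) (Shaped-trichotomy Q sh (Linked.tail r)))
  Shaped-trichotomy ((c , n , true) ∷ Q) sh r with inside-form c (n , true) Q sh r
  ... | M , S , lnk , eqv = stretching (replicate n c) c M S lnk λ w → ⇔.trans (Lang-flexible c n Q w) (mk⇔
    (λ (m , v , eq , l) → let (ms , eq′) = Equivalence.to (eqv v) l in
       m Vec.∷ ms , trans eq (trans (cong (λ x → replicate (suc m) c ++ replicate n c ++ x) eq′) (run-swap m ms)))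
    (λ { (m Vec.∷ ms , refl) → m , expand D M ms ++ S , sym (run-swap m ms) , Equivalence.from (eqv _) (ms , refl) }))
    where
    run-swap : ∀ m ms → replicate (suc m) c ++ replicate n c ++ expand D M ms ++ S
                      ≡ replicate n c ++ (replicate (suc m) c ++ expand D M ms) ++ S
    run-swap m ms =
      begin
        replicate (suc m) c ++ replicate n c ++ X
      ≡⟨ replicate-++ (suc m) n c X ⟩
        replicate (suc m ℕ.+ n) c ++ X
      ≡⟨ cong (λ j → replicate j c ++ X) (ℕₚ.+-comm (suc m) n) ⟩
        replicate (n ℕ.+ suc m) c ++ X
      ≡⟨ sym (replicate-++ n (suc m) c X) ⟩
        replicate n c ++ replicate (suc m) c ++ X
      ≡⟨ cong (replicate n c ++_) (sym (Listₚ.++-assoc (replicate (suc m) c) (expand D M ms) S)) ⟩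
        replicate n c ++ (replicate (suc m) c ++ expand D M ms) ++ S
      ∎
      where
      open ≡-Reasoning
      X = expand D M ms ++ S

  Lang-once-++ : ∀ P Q w → Lang (once P ++ Q) w ⇔ (Σ (List ℤ) λ v → w ≡ P ++ v × Lang Q v)
  Lang-once-++ []      Q w = mk⇔ (λ l → w , refl , l) (λ { (v , refl , l) → l })
  Lang-once-++ (c ∷ P) Q w = ⇔.trans (Lang-fixed c 0 (once P ++ Q) w) (mk⇔
    (λ { (v , refl , l) → let (v′ , eq , l′) = Equivalence.to (Lang-once-++ P Q v) l in v′ , cong (c ∷_) eq , l′ })
    (λ { (v , refl , l) → P ++ v , refl , Equivalence.from (Lang-once-++ P Q (P ++ v)) (v , refl , l) }))

  Lang-some-++ : ∀ M Q w → Lang (some M ++ Q) w ⇔ (Σ (Vec ℕ (List.length M)) λ ms → Σ (List ℤ) λ v → w ≡ expand D M ms ++ v × Lang Q v)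
  Lang-some-++ []      Q w = mk⇔ (λ l → Vec.[] , w , refl , l) (λ { (Vec.[] , v , refl , l) → l })
  Lang-some-++ (c ∷ M) Q w = ⇔.trans (Lang-flexible c 0 (some M ++ Q) w) (mk⇔
    (λ { (m , v , refl , l) → let (ms , v′ , eq , l′) = Equivalence.to (Lang-some-++ M Q v) l in
           m Vec.∷ ms , v′ , trans (cong (replicate (suc m) c ++_) eq) (sym (Listₚ.++-assoc (replicate (suc m) c) _ v′)) , l′ })
    (λ { (m Vec.∷ ms , v , refl , l) → m , expand D M ms ++ v , Listₚ.++-assoc (replicate (suc m) c) _ v ,
           Equivalence.from (Lang-some-++ M Q _) (ms , v , refl , l) }))

  Lang-once : ∀ S v → Lang (once S) v ⇔ v ≡ S
  Lang-once []      v = ⇔.refl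
  Lang-once (c ∷ S) v = ⇔.trans (Lang-fixed c 0 (once S) v) (mk⇔
    (λ { (v′ , refl , l) → cong (c ∷_) (Equivalence.to (Lang-once S v′) l) })
    (λ { refl → S , refl , Equivalence.from (Lang-once S S) refl }))

  Lang-class : ∀ P M S w → Lang (normalise (once P ++ some M ++ once S)) w ⇔ Stretching P M S w
  Lang-class P M S w =
    ⇔.trans (Lang-foldr-push (once P ++ some M ++ once S) [] w)
   (⇔.trans (subst (λ Q → Lang Q w ⇔ Lang (once P ++ some M ++ once S) w) (sym (Listₚ.++-identityʳ _)) ⇔.refl)
   (⇔.trans (Lang-once-++ P (some M ++ once S) w) (mk⇔
     (λ { (v , refl , l) → let (ms , v′ , eq , l′) = Equivalence.to (Lang-some-++ M (once S) v) l in
            ms , cong (P ++_) (trans eq (cong (expand D M ms ++_) (Equivalence.to (Lang-once S v′) l′))) })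
     (λ { (ms , refl) → expand D M ms ++ S , refl ,
            Equivalence.from (Lang-some-++ M (once S) _) (ms , S , refl , Equivalence.from (Lang-once S S) refl) }))))

  stretching-∩ : ∀ P₁ c₁ M₁ S₁ P₂ c₂ M₂ S₂ → Linked _≢_ (c₁ ∷ M₁) → Linked _≢_ (c₂ ∷ M₂) →
    Trichotomy (λ w → Stretching P₁ (c₁ ∷ M₁) S₁ w × Stretching P₂ (c₂ ∷ M₂) S₂ w)
  stretching-∩ P₁ c₁ M₁ S₁ P₂ c₂ M₂ S₂ lnk₁ lnk₂ = classify (meet? Q₁ Q₂ r₁ r₂)
    where
    Q₁ = normalise (once P₁ ++ some (c₁ ∷ M₁) ++ once S₁)
    Q₂ = normalise (once P₂ ++ some (c₂ ∷ M₂) ++ once S₂)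
    r₁ = Reduced-foldr-push (once P₁ ++ some (c₁ ∷ M₁) ++ once S₁) [] []
    r₂ = Reduced-foldr-push (once P₂ ++ some (c₂ ∷ M₂) ++ once S₂) [] []
    class₁ = λ w → Lang-class P₁ (c₁ ∷ M₁) S₁ w
    class₂ = λ w → Lang-class P₂ (c₂ ∷ M₂) S₂ w
    classify : (Σ (List Slot) λ Q₃ → Meet Q₁ Q₂ Q₃) ⊎ (∀ w → Lang Q₁ w → Lang Q₂ w → ⊥) →
               Trichotomy (λ w → Stretching P₁ (c₁ ∷ M₁) S₁ w × Stretching P₂ (c₂ ∷ M₂) S₂ w)
    classify (inj₂ disjoint) =
      empty λ w (s₁ , s₂) → disjoint w (Equivalence.from (class₁ w) s₁) (Equivalence.from (class₂ w) s₂)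
    classify (inj₁ (Q₃ , m)) =
      Trichotomy-resp (λ w → mk⇔
          (λ l → let (l₁ , l₂) = Lang-meet⁻ m l in Equivalence.to (class₁ w) l₁ , Equivalence.to (class₂ w) l₂)
          (λ (s₁ , s₂) → Lang-meet m r₁ r₂ (Equivalence.from (class₁ w) s₁) (Equivalence.from (class₂ w) s₂)))
        (Shaped-trichotomy Q₃
          (Shaped-meet before before m (normalise-class-Shaped P₁ c₁ M₁ S₁ lnk₁) (normalise-class-Shaped P₂ c₂ M₂ S₂ lnk₂))
          (Reduced-meet m r₁))

-- Intersecting two stretching classes

module ClassIntersection (D : ElasticCartan) (C₁ C₂ : SClass D) where
  open SClass
  open RootStretching D using (IsRoot-cong; root-expand)
  open StretchingWords D

  Both : Subset D
  Both = _∩_ D (classSet D C₁) (classSet D C₂)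

  Words : SClass D → List ℤ → Set
  Words C = Stretching (pre C) (midHead C ∷ midTail C) (suf C)

  Words-root : ∀ C {w} → Words C w → IsRoot D (base C) w
  Words-root C (ms , refl) = root-expand (base C) (pre C) (midHead C ∷ midTail C) (suf C) (baseRoot C) ms

  words-∩ : Trichotomy (λ w → Words C₁ w × Words C₂ w)
  words-∩ = stretching-∩ (pre C₁) (midHead C₁) (midTail C₁) (suf C₁) (pre C₂) (midHead C₂) (midTail C₂) (suf C₂)
                         (distinct C₁) (distinct C₂)

  different-bases : ¬ (∀ i → base C₁ i ≡ base C₂ i) → IsEmpty D Both
  different-bases bases≢ (g , w) ((_ , g≗₁ , _) , (_ , g≗₂ , _)) = bases≢ λ i → trans (sym (g≗₁ i)) (g≗₂ i)

  module _ (bases≡ : ∀ i → base C₁ i ≡ base C₂ i) where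

    member : ∀ g w → (∀ i → g i ≡ base C₁ i) → Words C₁ w × Words C₂ w → Both (g , w)
    member g w g≗ (s₁ , s₂) = (r , g≗ , s₁) , (r , (λ i → trans (g≗ i) (bases≡ i)) , s₂)
      where r = IsRoot-cong w (sym ∘ g≗) (Words-root C₁ s₁)

    equal-bases : Trichotomy (λ w → Words C₁ w × Words C₂ w) →
      IsEmpty D Both ⊎ IsSingleRoot D Both ⊎ IsStretchingClass D Both
    equal-bases (empty ∅) = inj₁ λ { (g , w) ((_ , _ , s₁) , (_ , _ , s₂)) → ∅ w (s₁ , s₂) }
    equal-bases (singleton w₀ eqv) = inj₂ (inj₁ (base C₁ , w₀ , λ g w → mk⇔
      (λ { ((_ , g≗ , s₁) , (_ , _ , s₂)) → g≗ , Equivalence.to (eqv w) (s₁ , s₂) })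
      (λ (g≗ , w≡w₀) → member g w g≗ (Equivalence.from (eqv w) w≡w₀))))
    equal-bases (stretching P c M S distinct′ eqv) = inj₂ (inj₂ (C₃ , λ { (g , w) → mk⇔
      (λ { ((r , g≗ , s₁) , (_ , _ , s₂)) → r , g≗ , Equivalence.to (eqv w) (s₁ , s₂) })
      (λ (_ , g≗ , s) → member g w g≗ (Equivalence.from (eqv w) s)) }))
      where
      baseWords : Words C₁ (P ++ (c ∷ M) ++ S)
      baseWords = proj₁ (Equivalence.from (eqv _) (Vec.replicate _ 0 , cong (λ X → P ++ X ++ S) (sym (expand-zeros (c ∷ M)))))
      C₃ : SClass D
      C₃ = record { base = base C₁ ; pre = P ; midHead = c ; midTail = M ; suf = S
                  ; distinct = distinct′ ; baseRoot = Words-root C₁ baseWords }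

lemma3p7 : (D : ElasticCartan) (C₁ C₂ : SClass D) →
    IsEmpty D (_∩_ D (classSet D C₁) (classSet D C₂))
    ⊎ IsSingleRoot D (_∩_ D (classSet D C₁) (classSet D C₂))
    ⊎ IsStretchingClass D (_∩_ D (classSet D C₁) (classSet D C₂))
lemma3p7 D C₁ C₂ with Finₚ.all? (λ i → SClass.base C₁ i ℤ.≟ SClass.base C₂ i)
... | no  bases≢ = inj₁ (different-bases bases≢)
  where open ClassIntersection D C₁ C₂
... | yes bases≡ = equal-bases bases≡ words-∩
  where open ClassIntersection D C₁ C₂
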